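{- Let $G$ be a dismantlable non-complete graph. Then $G$ is strongly $2$-monophonic if and only if $G$ has a non-empty set $U$ of universal vertices such that $G-U$ is a strongly $2$-monophonic graph without universal vertices.
   Context: All graphs are finite and simple. A vertex $v$ is universal if $N[v]=V(G)$. A vertex $u$ is dominated by a vertex $v\ne u$ if $N[u]\subseteq N[v]$. A graph of order at least $2$ is dismantlable if it has a vertex $u$ dominated by some other vertex such that $G-u$ is dismantlable, where $K_1$ is considered dismantlable (i.e., dominated vertices can be removed one by one until $K_1$ remains). For a graph $G$ and $u,v\in V(G)$, the monophonic interval $J_G(u,v)$ is the set of all vertices lying on some induced $u,v$-path in $G$, with the convention $u,v\in J_G(u,v)$ and $J_G(u,u)=\{u\}$. A set $S\subseteq V(G)$ is monophonic if for every $w\in V(G)$ there exist $x,y\in S$ with $w\in J_G(x,y)$; $m(G)$ is the minimum size of a monophonic set. $G$ is $2$-monophonic if $m(G)=2$, and strongly $2$-monophonic if it is $2$-monophonic and $\{x,y\}$ is a monophonic set for every pair of non-adjacent vertices $x,y$. -}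

module Defs where

open import Data.Nat using (ℕ; zero; suc; _≤_)
open import Data.Bool using (Bool; false; T)
open import Data.Fin using (Fin; toℕ; fromℕ)
open import Data.Fin.Subset using (Subset; _∈_; _∉_; _⊆_; ⁅_⁆; _∪_; _-_; ∣_∣; ⊤)
open import Data.Product using (Σ; ∃; ∃₂; _×_)
open import Data.Sum using (_⊎_)
open import Relation.Binary.PropositionalEquality using (_≡_; _≢_)
open import Relation.Nullary using (¬_)
open import Function.Bundles using (_⇔_)

record Graph (n : ℕ) : Set where
  field
    adj    : Fin n → Fin n → Bool
    sym    : ∀ u v → adj u v ≡ adj v u
    irrefl : ∀ v → adj v v ≡ false

module _ {n : ℕ} (G : Graph n) where
  open Graph G

  Adj : Fin n → Fin n → Set
  Adj u v = T (adj u v)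

  -- All notions below refer to the induced subgraph G[W] for W : Subset n.
  -- G itself is G[⊤]; G - U is G[∁ U].

  InClosedNbhd : Fin n → Fin n → Set
  InClosedNbhd v w = w ≡ v ⊎ Adj v w

  Universal : Subset n → Fin n → Set
  Universal W v = v ∈ W × (∀ w → w ∈ W → InClosedNbhd v w)

  Dominated : Subset n → Fin n → Fin n → Set
  Dominated W u v =
    u ∈ W × v ∈ W × u ≢ v ×
    (∀ w → w ∈ W → InClosedNbhd u w → InClosedNbhd v w)

  data Dismantlable : Subset n → Set where
    single : ∀ {W} → ∣ W ∣ ≡ 1 → Dismantlable W
    step   : ∀ {W u v} → 2 ≤ ∣ W ∣ → Dominated W u v →
             Dismantlable (W - u) → Dismantlable W

  record InducedPath (W : Subset n) (u v : Fin n) (k : ℕ) : Set where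
    field
      vert      : Fin (suc k) → Fin n
      start     : vert Fin.zero ≡ u
      end       : vert (fromℕ k) ≡ v
      inW       : ∀ i → vert i ∈ W
      injective : ∀ i j → vert i ≡ vert j → i ≡ j
      adjacency : ∀ i j →
        Adj (vert i) (vert j) ⇔ (suc (toℕ i) ≡ toℕ j ⊎ suc (toℕ j) ≡ toℕ i)

  InInterval : Subset n → Fin n → Fin n → Fin n → Set
  InInterval W u v w =
    w ≡ u ⊎ w ≡ v ⊎
    Σ ℕ (λ k → Σ (InducedPath W u v k) (λ P → ∃ λ i → InducedPath.vert P i ≡ w))

  Monophonic : Subset n → Subset n → Set
  Monophonic W S =
    S ⊆ W × (∀ w → w ∈ W → ∃₂ λ x y → x ∈ S × y ∈ S × InInterval W x y w)

  TwoMonophonic : Subset n → Set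
  TwoMonophonic W =
    (Σ (Subset n) λ S → Monophonic W S × ∣ S ∣ ≡ 2) ×
    (∀ S → Monophonic W S → 2 ≤ ∣ S ∣)

  StronglyTwoMonophonic : Subset n → Set
  StronglyTwoMonophonic W =
    TwoMonophonic W ×
    (∀ x y → x ∈ W → y ∈ W → x ≢ y → ¬ Adj x y → Monophonic W (⁅ x ⁆ ∪ ⁅ y ⁆))

  NoUniversal : Subset n → Set
  NoUniversal W = ∀ v → ¬ Universal W v

  Complete : Set
  Complete = ∀ x y → x ≢ y → Adj x y

-- A vertex u dominated by v cannot lie strictly inside an induced path ending at v: the two
-- path neighbours of u lie in N[v] but are two steps apart on the path.  So if every
-- non-adjacent pair {v, z} is monophonic, the dominator of any dominated vertex is universal,
-- and dismantlability supplies a dominated vertex.  Conversely, a universal vertex on an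
-- induced path is adjacent to every other vertex of it, so the path has at most three
-- vertices.  Hence an induced path between non-universal vertices either avoids the set U of
-- universal vertices or has its only interior vertex in U, and deleting U changes the
-- interval J(x, y) of non-adjacent x, y only by removing U, which lies in every such interval.
module Submission where

open import Defs
open import Data.Nat using (ℕ; zero; suc; _≤_; s≤s)
open import Data.Nat.Properties using (suc-injective; ≤-refl; ≤-trans; ≤-reflexive; ≤-antisym; n≤1+n)
open import Data.Bool using (T)
open import Data.Bool.Properties using (T?)
open import Data.Fin using (Fin; toℕ; fromℕ; lower₁; inject₁; _≟_) renaming (zero to fzero; suc to fsuc)
open import Data.Fin.Properties using (toℕ-injective; toℕ-fromℕ; toℕ-lower₁; toℕ-inject₁; toℕ≤pred[n]; all?; any?)
open import Data.Fin.Subset using (Subset; _∈_; _∉_; _⊆_; ⁅_⁆; _∪_; ∣_∣; ⊤; ∁; Nonempty; inside)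
open import Data.Fin.Subset.Properties
  using (∈⊤; x∈⁅x⁆; x∈⁅y⁆⇒x≡y; x≢y⇒x∉⁅y⁆; ∣⁅x⁆∣≡1; ∪-identityˡ; ∪-identityʳ; x∈p∪q⁻; x∈p∪q⁺;
         p⊂q⇒∣p∣<∣q∣; x∉p⇒x∈∁p; x∈∁p⇒x∉p; _∈?_)
open import Data.Vec using (tabulate)
open import Data.Vec.Properties using (lookup⇒[]=; []=⇒lookup; lookup∘tabulate)
open import Data.Product using (Σ; ∃; ∃₂; _×_; _,_; proj₂; map₂)
open import Data.Sum using (_⊎_; inj₁; inj₂)
open import Data.Empty using (⊥-elim)
open import Function using (_∘_)
open import Relation.Nullary using (¬_; Dec; yes; no; does; ¬?; contradiction)
open import Relation.Nullary.Decidable using (map′; _⊎-dec_; _×-dec_; dec-true; dec-false; decidable-stable)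
open import Relation.Binary.PropositionalEquality using (_≡_; _≢_; refl; sym; trans; cong; subst)
open import Function.Bundles using (_⇔_; mk⇔; Equivalence)

∣⁅x⁆∪⁅y⁆∣≡2 : ∀ {n} (x y : Fin n) → x ≢ y → ∣ ⁅ x ⁆ ∪ ⁅ y ⁆ ∣ ≡ 2
∣⁅x⁆∪⁅y⁆∣≡2 fzero    fzero    x≢y = ⊥-elim (x≢y refl)
∣⁅x⁆∪⁅y⁆∣≡2 fzero    (fsuc y) _   = cong suc (trans (cong ∣_∣ (∪-identityˡ ⁅ y ⁆)) (∣⁅x⁆∣≡1 y))
∣⁅x⁆∪⁅y⁆∣≡2 (fsuc x) fzero    _   = cong suc (trans (cong ∣_∣ (∪-identityʳ ⁅ x ⁆)) (∣⁅x⁆∣≡1 x))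
∣⁅x⁆∪⁅y⁆∣≡2 (fsuc x) (fsuc y) x≢y = ∣⁅x⁆∪⁅y⁆∣≡2 x y (x≢y ∘ cong fsuc)

module _ {n : ℕ} where

  x∈⁅x⁆∪⁅y⁆ : (x y : Fin n) → x ∈ ⁅ x ⁆ ∪ ⁅ y ⁆
  x∈⁅x⁆∪⁅y⁆ x y = x∈p∪q⁺ (inj₁ (x∈⁅x⁆ x))

  y∈⁅x⁆∪⁅y⁆ : (x y : Fin n) → y ∈ ⁅ x ⁆ ∪ ⁅ y ⁆
  y∈⁅x⁆∪⁅y⁆ x y = x∈p∪q⁺ (inj₂ (x∈⁅x⁆ y))

  x∈⁅y⁆∪⁅z⁆⇒ : ∀ {x y z : Fin n} → x ∈ ⁅ y ⁆ ∪ ⁅ z ⁆ → x ≡ y ⊎ x ≡ z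
  x∈⁅y⁆∪⁅z⁆⇒ {y = y} {z} x∈ with x∈p∪q⁻ ⁅ y ⁆ ⁅ z ⁆ x∈
  ... | inj₁ x∈⁅y⁆ = inj₁ (x∈⁅y⁆⇒x≡y y x∈⁅y⁆)
  ... | inj₂ x∈⁅z⁆ = inj₂ (x∈⁅y⁆⇒x≡y z x∈⁅z⁆)

  ⁅x⁆∪⁅y⁆⊆ : ∀ {x y : Fin n} {S : Subset n} → x ∈ S → y ∈ S → ⁅ x ⁆ ∪ ⁅ y ⁆ ⊆ S
  ⁅x⁆∪⁅y⁆⊆ x∈S y∈S z∈ with x∈⁅y⁆∪⁅z⁆⇒ z∈
  ... | inj₁ refl = x∈S
  ... | inj₂ refl = y∈S

  ∈⁅x⁆∪⁅y⁆-cover : ∀ {x y a b : Fin n} → a ∈ ⁅ x ⁆ ∪ ⁅ y ⁆ → b ∈ ⁅ x ⁆ ∪ ⁅ y ⁆ →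
    x ≡ a ⊎ x ≡ b ⊎ a ≡ b
  ∈⁅x⁆∪⁅y⁆-cover a∈ b∈ with x∈⁅y⁆∪⁅z⁆⇒ a∈ | x∈⁅y⁆∪⁅z⁆⇒ b∈
  ... | inj₁ refl | _         = inj₁ refl
  ... | inj₂ _    | inj₁ refl = inj₂ (inj₁ refl)
  ... | inj₂ refl | inj₂ refl = inj₂ (inj₂ refl)

  2≤∣p∣ : ∀ {x y : Fin n} {p : Subset n} → x ∈ p → y ∈ p → x ≢ y → 2 ≤ ∣ p ∣
  2≤∣p∣ {x} {y} {p} x∈p y∈p x≢y = subst (_≤ ∣ p ∣) (cong suc (∣⁅x⁆∣≡1 x))
    (p⊂q⇒∣p∣<∣q∣ (⁅x⁆⊆p , y , y∈p , x≢y⇒x∉⁅y⁆ (x≢y ∘ sym)))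
    where
    ⁅x⁆⊆p : ⁅ x ⁆ ⊆ p
    ⁅x⁆⊆p z∈⁅x⁆ = subst (_∈ p) (sym (x∈⁅y⁆⇒x≡y x z∈⁅x⁆)) x∈p

Successive : ℕ → ℕ → Set
Successive x y = suc x ≡ y ⊎ suc y ≡ x

Near : ℕ → ℕ → Set
Near x y = x ≡ y ⊎ Successive y x

near-pred⇒≤ : ∀ {p i j} → suc p ≡ i → Near p j → j ≤ i
near-pred⇒≤ refl (inj₁ refl)        = n≤1+n _
near-pred⇒≤ refl (inj₂ (inj₁ refl)) = ≤-trans (n≤1+n _) (n≤1+n _)
near-pred⇒≤ refl (inj₂ (inj₂ refl)) = ≤-refl

near-succ⇒≥ : ∀ {i s j} → suc i ≡ s → Near s j → i ≤ j
near-succ⇒≥ refl (inj₁ refl)        = n≤1+n _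
near-succ⇒≥ refl (inj₂ (inj₁ e))    = ≤-reflexive (sym (suc-injective e))
near-succ⇒≥ refl (inj₂ (inj₂ refl)) = ≤-trans (n≤1+n _) (n≤1+n _)

-- 0's only successor is 1, whose successors are 0 and 2.
at-most-two-successive : ∀ {i j k} → Successive j 0 → Successive j i → Successive j k → j ≤ k →
  i ≡ 0 ⊎ i ≡ k
at-most-two-successive (inj₂ refl) (inj₂ refl) _           _         = inj₁ refl
at-most-two-successive (inj₂ refl) (inj₁ refl) (inj₁ refl) _         = inj₂ refl
at-most-two-successive (inj₂ refl) (inj₁ refl) (inj₂ refl) ()

∃-successor : ∀ {k} (i : Fin (suc k)) → i ≢ fromℕ k → ∃ λ (j : Fin (suc k)) → suc (toℕ i) ≡ toℕ j
∃-successor {k} i i≢k = fsuc (lower₁ i k≢i) , cong suc (sym (toℕ-lower₁ i k≢i))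
  where
  k≢i : k ≢ toℕ i
  k≢i k≡i = i≢k (toℕ-injective (trans (sym k≡i) (sym (toℕ-fromℕ k))))

∃-predecessor : ∀ {k} (i : Fin (suc k)) → i ≢ fzero → ∃ λ (j : Fin (suc k)) → suc (toℕ j) ≡ toℕ i
∃-predecessor fzero    i≢0 = ⊥-elim (i≢0 refl)
∃-predecessor (fsuc i) _   = inject₁ i , cong suc (toℕ-inject₁ i)

module _ {n : ℕ} (G : Graph n) where

  Adj-sym : ∀ {u v} → Adj G u v → Adj G v u
  Adj-sym {u} {v} = subst T (Graph.sym G u v)

  Adj-irrefl : ∀ {v} → ¬ Adj G v v
  Adj-irrefl {v} v~v with subst T (Graph.irrefl G v) v~v
  ... | ()

  universal-closedNbhd : ∀ {v} → Universal G ⊤ v → ∀ w → InClosedNbhd G v w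
  universal-closedNbhd (_ , v~) w = v~ w ∈⊤

  universal-adj : ∀ {v w} → Universal G ⊤ v → w ≢ v → Adj G v w
  universal-adj {w = w} univ w≢v with universal-closedNbhd univ w
  ... | inj₁ w≡v = ⊥-elim (w≢v w≡v)
  ... | inj₂ v~w = v~w

  universal? : ∀ v → Dec (Universal G ⊤ v)
  universal? v = map′ (λ v~ → ∈⊤ , λ w _ → v~ w) universal-closedNbhd
    (all? λ w → (w ≟ v) ⊎-dec T? (Graph.adj G v w))

  nonadjacent⇒¬universal : ∀ {x y} → x ≢ y → ¬ Adj G x y → ¬ Universal G ⊤ x
  nonadjacent⇒¬universal x≢y x≁y univ = x≁y (universal-adj univ (x≢y ∘ sym))

  ¬complete⇒nonadjacent : ¬ Complete G → ∃₂ λ x y → x ≢ y × ¬ Adj G x y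
  ¬complete⇒nonadjacent ¬complete
    with any? (λ x → any? (λ y → ¬? (x ≟ y) ×-dec ¬? (T? (Graph.adj G x y))))
  ... | yes (x , y , x≢y , x≁y) = x , y , x≢y , x≁y
  ... | no ¬nonadjacent = ⊥-elim (¬complete complete)
    where
    complete : Complete G
    complete x y x≢y with T? (Graph.adj G x y)
    ... | yes x~y = x~y
    ... | no x≁y = ⊥-elim (¬nonadjacent (x , y , x≢y , x≁y))

  module _ {W a b k} (P : InducedPath G W a b k) where
    open InducedPath P

    closedNbhd⇒near : ∀ i j → InClosedNbhd G (vert i) (vert j) → Near (toℕ j) (toℕ i)
    closedNbhd⇒near i j (inj₁ vj≡vi) = inj₁ (cong toℕ (injective j i vj≡vi))
    closedNbhd⇒near i j (inj₂ vi~vj) = inj₂ (Equivalence.to (adjacency i j) vi~vj)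

    successive⇒closedNbhd : ∀ i j → Successive (toℕ i) (toℕ j) → InClosedNbhd G (vert i) (vert j)
    successive⇒closedNbhd i j = inj₂ ∘ Equivalence.from (adjacency i j)

    -- The two path neighbours of an interior vertex are at distance 2, so no other path
    -- vertex is close to both of them.
    interior-¬dominated : ∀ {i j} → i ≢ fzero → i ≢ fromℕ k → j ≢ i →
      ¬ (∀ w → InClosedNbhd G (vert i) w → InClosedNbhd G (vert j) w)
    interior-¬dominated {i} {j} i≢0 i≢k j≢i dom with ∃-predecessor i i≢0 | ∃-successor i i≢k
    ... | p , p+1≡i | s , i+1≡s = j≢i (toℕ-injective (≤-antisym
      (near-pred⇒≤ p+1≡i (closedNbhd⇒near j p (dom (vert p) (successive⇒closedNbhd i p (inj₂ p+1≡i)))))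
      (near-succ⇒≥ i+1≡s (closedNbhd⇒near j s (dom (vert s) (successive⇒closedNbhd i s (inj₁ i+1≡s)))))))

    universal-successive : ∀ {j} → (∀ w → InClosedNbhd G (vert j) w) →
      ∀ l → l ≢ j → Successive (toℕ j) (toℕ l)
    universal-successive {j} univ l l≢j with univ (vert l)
    ... | inj₁ vl≡vj = ⊥-elim (l≢j (injective l j vl≡vj))
    ... | inj₂ vj~vl = Equivalence.to (adjacency j l) vj~vl

    universal-interior-unique : ∀ {j} → (∀ w → InClosedNbhd G (vert j) w) → j ≢ fzero → j ≢ fromℕ k →
      ∀ {i} → i ≢ fzero → i ≢ fromℕ k → i ≡ j
    universal-interior-unique {j} univ j≢0 j≢k {i} i≢0 i≢k with i ≟ j
    ... | yes i≡j = i≡j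
    ... | no i≢j
      with at-most-two-successive (universal-successive univ fzero (j≢0 ∘ sym))
             (universal-successive univ i i≢j) (universal-successive univ (fromℕ k) (j≢k ∘ sym))
             (subst (toℕ j ≤_) (sym (toℕ-fromℕ k)) (toℕ≤pred[n] j))
    ...   | inj₁ i≡0 = ⊥-elim (i≢0 (toℕ-injective i≡0))
    ...   | inj₂ i≡k = ⊥-elim (i≢k (toℕ-injective i≡k))

  inducedPath-within : ∀ {W W′ a b k} (P : InducedPath G W a b k) →
    (∀ i → InducedPath.vert P i ∈ W′) → InducedPath G W′ a b k
  inducedPath-within P inW′ = record
    { vert = vert ; start = start ; end = end ; inW = inW′ ; injective = injective ; adjacency = adjacency }
    where open InducedPath P

  interval-mono : ∀ {W W′ a b w} → W ⊆ W′ → InInterval G W a b w → InInterval G W′ a b w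
  interval-mono _    (inj₁ w≡a)                  = inj₁ w≡a
  interval-mono _    (inj₂ (inj₁ w≡b))           = inj₂ (inj₁ w≡b)
  interval-mono W⊆W′ (inj₂ (inj₂ (k , P , i , vi≡w))) =
    inj₂ (inj₂ (k , inducedPath-within P (W⊆W′ ∘ InducedPath.inW P) , i , vi≡w))

  interval-self : ∀ {W a w} → InInterval G W a a w → w ≡ a
  interval-self (inj₁ w≡a)                                    = w≡a
  interval-self (inj₂ (inj₁ w≡a))                             = w≡a
  interval-self (inj₂ (inj₂ (zero , P , fzero , v0≡w)))       = trans (sym v0≡w) (InducedPath.start P)
  interval-self (inj₂ (inj₂ (suc k , P , _ , _)))
    with InducedPath.injective P fzero (fromℕ (suc k)) (trans (InducedPath.start P) (sym (InducedPath.end P)))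
  ... | ()

  Interior : ∀ {W a b k} → InducedPath G W a b k → Fin n → Set
  Interior {k = k} P w = ∃ λ i → InducedPath.vert P i ≡ w × i ≢ fzero × i ≢ fromℕ k

  interval-interior : ∀ {W a b w} → InInterval G W a b w → w ≢ a → w ≢ b →
    ∃₂ λ k (P : InducedPath G W a b k) → Interior P w
  interval-interior (inj₁ w≡a)        w≢a _   = ⊥-elim (w≢a w≡a)
  interval-interior (inj₂ (inj₁ w≡b)) _   w≢b = ⊥-elim (w≢b w≡b)
  interval-interior (inj₂ (inj₂ (k , P , i , vi≡w))) w≢a w≢b = k , P , i , vi≡w , i≢0 , i≢k
    where
    open InducedPath P
    i≢0 : i ≢ fzero
    i≢0 i≡0 = w≢a (trans (sym vi≡w) (trans (cong vert i≡0) start))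
    i≢k : i ≢ fromℕ k
    i≢k i≡k = w≢b (trans (sym vi≡w) (trans (cong vert i≡k) end))

  ¬dominated-inInterval : ∀ {W a b u v} → (∀ w → InClosedNbhd G u w → InClosedNbhd G v w) →
    u ≢ a → u ≢ b → v ≡ a ⊎ v ≡ b → ¬ InInterval G W a b u
  ¬dominated-inInterval {a = a} {b} {v = v} dom u≢a u≢b v∈ab u∈J with interval-interior u∈J u≢a u≢b
  ... | k , P , i , refl , i≢0 , i≢k = at-end v∈ab
    where
    open InducedPath P
    dominated-by : ∀ {e} → vert e ≡ v → ∀ w → InClosedNbhd G (vert i) w → InClosedNbhd G (vert e) w
    dominated-by ve≡v w = subst (λ c → InClosedNbhd G c w) (sym ve≡v) ∘ dom w
    at-end : ¬ (v ≡ a ⊎ v ≡ b)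
    at-end (inj₁ v≡a) = interior-¬dominated P {j = fzero} i≢0 i≢k (i≢0 ∘ sym) (dominated-by (trans start (sym v≡a)))
    at-end (inj₂ v≡b) = interior-¬dominated P {j = fromℕ k} i≢0 i≢k (i≢k ∘ sym) (dominated-by (trans end (sym v≡b)))

  monophonic-size : ∀ {W S x y} → x ∈ W → y ∈ W → x ≢ y → Monophonic G W S → 2 ≤ ∣ S ∣
  monophonic-size x∈W y∈W x≢y (_ , cover) with cover _ x∈W | cover _ y∈W
  ... | a , b , a∈S , b∈S , x∈J | c , d , c∈S , d∈S , y∈J with a ≟ b | c ≟ d
  ... | no a≢b   | _        = 2≤∣p∣ a∈S b∈S a≢b
  ... | yes _    | no c≢d   = 2≤∣p∣ c∈S d∈S c≢d
  ... | yes refl | yes refl =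
    2≤∣p∣ a∈S c∈S (λ a≡c → x≢y (trans (interval-self x∈J) (trans a≡c (sym (interval-self y∈J)))))

  PairsMonophonic : Subset n → Set
  PairsMonophonic W =
    ∀ x y → x ∈ W → y ∈ W → x ≢ y → ¬ Adj G x y → Monophonic G W (⁅ x ⁆ ∪ ⁅ y ⁆)

  pairsMonophonic⇒strongly2Monophonic : ∀ {W x y} → PairsMonophonic W →
    x ∈ W → y ∈ W → x ≢ y → ¬ Adj G x y → StronglyTwoMonophonic G W
  pairsMonophonic⇒strongly2Monophonic {x = x} {y} pairs x∈W y∈W x≢y x≁y =
    ((⁅ x ⁆ ∪ ⁅ y ⁆ , pairs x y x∈W y∈W x≢y x≁y , ∣⁅x⁆∪⁅y⁆∣≡2 x y x≢y) , λ _ → monophonic-size x∈W y∈W x≢y) ,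
    pairs

  dominator-universal : PairsMonophonic ⊤ → ∀ {u v} → u ≢ v →
    (∀ w → InClosedNbhd G u w → InClosedNbhd G v w) → Universal G ⊤ v
  dominator-universal pairs {u} {v} u≢v dom = ∈⊤ , λ z _ → closed z
    where
    v~u : Adj G v u
    v~u with dom u (inj₁ refl)
    ... | inj₁ u≡v = ⊥-elim (u≢v u≡v)
    ... | inj₂ v~u = v~u
    closed : ∀ z → InClosedNbhd G v z
    closed z with z ≟ v | T? (Graph.adj G v z)
    ... | yes z≡v | _        = inj₁ z≡v
    ... | no _    | yes v~z  = inj₂ v~z
    ... | no z≢v  | no v≁z   = ⊥-elim (uncovered (proj₂ (pairs v z ∈⊤ ∈⊤ (z≢v ∘ sym) v≁z) u ∈⊤))
      where
      u∉ : ∀ {c} → c ∈ ⁅ v ⁆ ∪ ⁅ z ⁆ → u ≢ c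
      u∉ c∈ u≡c with x∈⁅y⁆∪⁅z⁆⇒ c∈
      ... | inj₁ refl = u≢v u≡c
      ... | inj₂ refl = v≁z (subst (Adj G v) u≡c v~u)
      uncovered : ¬ ∃₂ λ a b → a ∈ ⁅ v ⁆ ∪ ⁅ z ⁆ × b ∈ ⁅ v ⁆ ∪ ⁅ z ⁆ × InInterval G ⊤ a b u
      uncovered (a , b , a∈ , b∈ , u∈J) with ∈⁅x⁆∪⁅y⁆-cover a∈ b∈
      ... | inj₁ v≡a         = ¬dominated-inInterval dom (u∉ a∈) (u∉ b∈) (inj₁ v≡a) u∈J
      ... | inj₂ (inj₁ v≡b)  = ¬dominated-inInterval dom (u∉ a∈) (u∉ b∈) (inj₂ v≡b) u∈J
      ... | inj₂ (inj₂ refl) = u∉ a∈ (interval-self u∈J)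

  dismantlable⇒universal : ∀ {x y} → x ≢ y → PairsMonophonic ⊤ → Dismantlable G ⊤ →
    ∃ λ v → Universal G ⊤ v
  dismantlable⇒universal x≢y _ (single ∣⊤∣≡1) with subst (2 ≤_) ∣⊤∣≡1 (2≤∣p∣ {p = ⊤ {n}} ∈⊤ ∈⊤ x≢y)
  ... | s≤s ()
  dismantlable⇒universal _ pairs (step {v = v} _ (_ , _ , u≢v , dom) _) =
    v , dominator-universal pairs u≢v (λ w → dom w ∈⊤)

  universals : Subset n
  universals = tabulate (does ∘ universal?)

  ∈universals⁺ : ∀ {v} → Universal G ⊤ v → v ∈ universals
  ∈universals⁺ {v} univ =
    lookup⇒[]= v universals (trans (lookup∘tabulate (does ∘ universal?) v) (dec-true (universal? v) univ))

  ∈universals⁻ : ∀ {v} → v ∈ universals → Universal G ⊤ v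
  ∈universals⁻ {v} v∈ = decidable-stable (universal? v) λ ¬univ →
    contradiction (trans (sym is-inside) (dec-false (universal? v) ¬univ)) λ ()
    where
    is-inside : does (universal? v) ≡ inside
    is-inside = trans (sym (lookup∘tabulate (does ∘ universal?) v)) ([]=⇒lookup v∈)

  noUniversal-∁universals : NoUniversal G (∁ universals)
  noUniversal-∁universals v (v∈∁ , v~) = x∈∁p⇒x∉p v∈∁ (∈universals⁺ (∈⊤ , λ w _ → closed w))
    where
    closed : ∀ w → InClosedNbhd G v w
    closed w with w ∈? universals
    ... | no w∉ = v~ w (x∉p⇒x∈∁p w∉)
    ... | yes w∈ with universal-closedNbhd (∈universals⁻ w∈) v
    ...   | inj₁ v≡w = inj₁ (sym v≡w)
    ...   | inj₂ w~v = inj₂ (Adj-sym w~v)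

  nonadjacent∈∁universal : ∀ {U x y} → (∀ u → u ∈ U → Universal G ⊤ u) →
    x ≢ y → ¬ Adj G x y → x ∈ ∁ U
  nonadjacent∈∁universal univ x≢y x≁y = x∉p⇒x∈∁p (nonadjacent⇒¬universal x≢y x≁y ∘ univ _)

  interval-∁universal : ∀ {U a b w} → (∀ u → u ∈ U → Universal G ⊤ u) →
    a ∉ U → b ∉ U → w ∉ U → InInterval G ⊤ a b w → InInterval G (∁ U) a b w
  interval-∁universal {U} {a} {b} {w} univ a∉U b∉U w∉U w∈J with w ≟ a | w ≟ b
  ... | yes w≡a | _       = inj₁ w≡a
  ... | no _    | yes w≡b = inj₂ (inj₁ w≡b)
  ... | no w≢a  | no w≢b with interval-interior w∈J w≢a w≢b
  ...   | k , P , i , vi≡w , i≢0 , i≢k = inj₂ (inj₂ (k , inducedPath-within P avoids-U , i , vi≡w))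
    where
    open InducedPath P
    avoids-U : ∀ j → vert j ∈ ∁ U
    avoids-U j = x∉p⇒x∈∁p λ vj∈U → w∉U (subst (_∈ U) (vj≡w vj∈U) vj∈U)
      where
      vj≡w : vert j ∈ U → vert j ≡ w
      vj≡w vj∈U = trans (cong vert (sym (universal-interior-unique P (universal-closedNbhd (univ _ vj∈U))
        (λ j≡0 → a∉U (subst (_∈ U) (trans (cong vert j≡0) start) vj∈U))
        (λ j≡k → b∉U (subst (_∈ U) (trans (cong vert j≡k) end) vj∈U)) i≢0 i≢k))) vi≡w

  universal-inducedPath : ∀ {x y u} → x ≢ y → ¬ Adj G x y → Universal G ⊤ u → InducedPath G ⊤ x y 2
  universal-inducedPath {x} {y} {u} x≢y x≁y univ = record
    { vert = vert ; start = refl ; end = refl ; inW = λ _ → ∈⊤ ; injective = injective ; adjacency = adjacency }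
    where
    x≢u : x ≢ u
    x≢u x≡u = nonadjacent⇒¬universal x≢y x≁y (subst (Universal G ⊤) (sym x≡u) univ)
    y≢u : y ≢ u
    y≢u y≡u = nonadjacent⇒¬universal (x≢y ∘ sym) (x≁y ∘ Adj-sym) (subst (Universal G ⊤) (sym y≡u) univ)
    u~x : Adj G u x
    u~x = universal-adj univ x≢u
    u~y : Adj G u y
    u~y = universal-adj univ y≢u
    vert : Fin 3 → Fin n
    vert fzero               = x
    vert (fsuc fzero)        = u
    vert (fsuc (fsuc fzero)) = y
    injective : ∀ i j → vert i ≡ vert j → i ≡ j
    injective fzero               fzero               _   = refl
    injective fzero               (fsuc fzero)        x≡u = ⊥-elim (x≢u x≡u)
    injective fzero               (fsuc (fsuc fzero)) x≡y = ⊥-elim (x≢y x≡y)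
    injective (fsuc fzero)        fzero               u≡x = ⊥-elim (x≢u (sym u≡x))
    injective (fsuc fzero)        (fsuc fzero)        _   = refl
    injective (fsuc fzero)        (fsuc (fsuc fzero)) u≡y = ⊥-elim (y≢u (sym u≡y))
    injective (fsuc (fsuc fzero)) fzero               y≡x = ⊥-elim (x≢y (sym y≡x))
    injective (fsuc (fsuc fzero)) (fsuc fzero)        y≡u = ⊥-elim (y≢u y≡u)
    injective (fsuc (fsuc fzero)) (fsuc (fsuc fzero)) _   = refl
    empty⇔empty : ∀ {i j} → ¬ Adj G (vert i) (vert j) → ¬ Successive (toℕ i) (toℕ j) →
      Adj G (vert i) (vert j) ⇔ Successive (toℕ i) (toℕ j)
    empty⇔empty ¬adj ¬succ = mk⇔ (⊥-elim ∘ ¬adj) (⊥-elim ∘ ¬succ)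
    adjacency : ∀ i j → Adj G (vert i) (vert j) ⇔ Successive (toℕ i) (toℕ j)
    adjacency fzero               fzero               = empty⇔empty Adj-irrefl λ { (inj₁ ()) ; (inj₂ ()) }
    adjacency fzero               (fsuc fzero)        = mk⇔ (λ _ → inj₁ refl) (λ _ → Adj-sym u~x)
    adjacency fzero               (fsuc (fsuc fzero)) = empty⇔empty x≁y λ { (inj₁ ()) ; (inj₂ ()) }
    adjacency (fsuc fzero)        fzero               = mk⇔ (λ _ → inj₂ refl) (λ _ → u~x)
    adjacency (fsuc fzero)        (fsuc fzero)        = empty⇔empty Adj-irrefl λ { (inj₁ ()) ; (inj₂ ()) }
    adjacency (fsuc fzero)        (fsuc (fsuc fzero)) = mk⇔ (λ _ → inj₁ refl) (λ _ → u~y)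
    adjacency (fsuc (fsuc fzero)) fzero               = empty⇔empty (x≁y ∘ Adj-sym) λ { (inj₁ ()) ; (inj₂ ()) }
    adjacency (fsuc (fsuc fzero)) (fsuc fzero)        = mk⇔ (λ _ → inj₂ refl) (λ _ → Adj-sym u~y)
    adjacency (fsuc (fsuc fzero)) (fsuc (fsuc fzero)) = empty⇔empty Adj-irrefl λ { (inj₁ ()) ; (inj₂ ()) }

  pairsMonophonic-∁universal : ∀ {U} → (∀ u → u ∈ U → Universal G ⊤ u) →
    PairsMonophonic ⊤ → PairsMonophonic (∁ U)
  pairsMonophonic-∁universal {U} univ pairs x y x∈ y∈ x≢y x≁y = ⁅x⁆∪⁅y⁆⊆ x∈ y∈ , cover
    where
    cover : ∀ w → w ∈ ∁ U →
      ∃₂ λ a b → a ∈ ⁅ x ⁆ ∪ ⁅ y ⁆ × b ∈ ⁅ x ⁆ ∪ ⁅ y ⁆ × InInterval G (∁ U) a b w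
    cover w w∈ with proj₂ (pairs x y ∈⊤ ∈⊤ x≢y x≁y) w ∈⊤
    ... | a , b , a∈ , b∈ , w∈J = a , b , a∈ , b∈ ,
      interval-∁universal univ (∉U a∈) (∉U b∈) (x∈∁p⇒x∉p w∈) w∈J
      where
      ∉U : ∀ {c} → c ∈ ⁅ x ⁆ ∪ ⁅ y ⁆ → c ∉ U
      ∉U = x∈∁p⇒x∉p ∘ ⁅x⁆∪⁅y⁆⊆ x∈ y∈

  pairsMonophonic-⊤ : ∀ {U} → (∀ u → u ∈ U → Universal G ⊤ u) →
    PairsMonophonic (∁ U) → PairsMonophonic ⊤
  pairsMonophonic-⊤ {U} univ pairs x y _ _ x≢y x≁y = (λ _ → ∈⊤) , cover
    where
    cover : ∀ w → w ∈ ⊤ →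
      ∃₂ λ a b → a ∈ ⁅ x ⁆ ∪ ⁅ y ⁆ × b ∈ ⁅ x ⁆ ∪ ⁅ y ⁆ × InInterval G ⊤ a b w
    cover w _ with w ∈? U
    ... | yes w∈U = x , y , x∈⁅x⁆∪⁅y⁆ x y , y∈⁅x⁆∪⁅y⁆ x y ,
      inj₂ (inj₂ (2 , universal-inducedPath x≢y x≁y (univ w w∈U) , fsuc fzero , refl))
    ... | no w∉U
      with proj₂ (pairs x y (nonadjacent∈∁universal univ x≢y x≁y)
                     (nonadjacent∈∁universal univ (x≢y ∘ sym) (x≁y ∘ Adj-sym)) x≢y x≁y) w (x∉p⇒x∈∁p w∉U)
    ...   | a , b , a∈ , b∈ , w∈J = a , b , a∈ , b∈ , interval-mono (λ _ → ∈⊤) w∈J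

proposition3p7 : ∀ {n : ℕ} (G : Graph n) → Dismantlable G ⊤ → ¬ Complete G →
    StronglyTwoMonophonic G ⊤ ⇔
      Σ (Subset n) (λ U → Nonempty U × (∀ u → u ∈ U → Universal G ⊤ u) ×
        StronglyTwoMonophonic G (∁ U) × NoUniversal G (∁ U))
proposition3p7 G dismantlable ¬complete with ¬complete⇒nonadjacent G ¬complete
... | x , y , x≢y , x≁y = mk⇔
  (λ (_ , pairs) →
    universals G , map₂ (∈universals⁺ G) (dismantlable⇒universal G x≢y pairs dismantlable) , universal ,
    pairsMonophonic⇒strongly2Monophonic G (pairsMonophonic-∁universal G universal pairs)
      (nonadjacent∈∁universal G universal x≢y x≁y)
      (nonadjacent∈∁universal G universal (x≢y ∘ sym) (x≁y ∘ Adj-sym G)) x≢y x≁y ,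
    noUniversal-∁universals G)
  (λ (U , _ , universal , (_ , pairs) , _) →
    pairsMonophonic⇒strongly2Monophonic G (pairsMonophonic-⊤ G universal pairs) ∈⊤ ∈⊤ x≢y x≁y)
  where
  universal : ∀ u → u ∈ universals G → Universal G ⊤ u
  universal _ = ∈universals⁻ G
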